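{- Let $(\mathsf D,\Upsilon)$ be a rank $r$ semistandard $(m,n)$-parking function. Then \[ \mathrm{codinv}(\mathsf D,\Upsilon)=\sum_{b\text{ area box of }\mathsf D}\mathrm{codinv}_b(\mathsf D,\Upsilon)+\sum_{b\text{ path box of }\mathsf D}\mathrm{codinv}_b(\mathsf D,\Upsilon). \]
   Context: Fix coprime positive integers $m,n$ and a positive integer $r$. An $(m,n)$-Dyck path $\mathsf D$ is a lattice path from $(0,m)$ to $(n,0)$ of unit south and east steps staying weakly below $mx+ny=mn$; vertical steps $v_0,\dots,v_{m-1}$ (top to bottom) with top endpoints $(a_j,m-j)$, identified with $v_j$; consecutive if $a_j=a_{j+1}$. $\gamma(x,y)=mn-mx-ny$. A rank $r$ semistandard $(m,n)$-parking function is $(\mathsf D,\Upsilon)$, $\Upsilon:\{v_j\}\to\{1,\dots,r\}$, $\Upsilon(v_j)\le\Upsilon(v_{j+1})$ for consecutive steps; weight $\mathbf w=(|\Upsilon^{ -1}(i)|)_i$. Parking functions $(\mathsf D,\varphi)$: $\varphi$ bijective onto $\{1,\dots,m\}$, strictly increasing on consecutive steps; set $\mathrm{PF}_{m,n}$. $\widetilde S_m$: bijections $\sigma$ of $\mathbb Z$ with $\sigma(x+m)=\sigma(x)+m$, $\sum_{i=1}^m\sigma(i)=m(m+1)/2$. $\mathcal A_{\mathbf w}(\mathsf D,\Upsilon)(x)=\tilde f(x+k)$ where $\tilde f(\gamma(v_j)+pm)=\Upsilon(v_j)+pr$ ($p\in\mathbb Z$) and $\sum_j(\gamma(v_j)-(j+1))=km$;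 $\mathcal A=\mathcal A_{(1^m)}$ is a bijection from $\mathrm{PF}_{m,n}$ to $n$-stable elements of $\widetilde S_m$. $f_{\mathbf w}(x)=i$ for $w_1+\dots+w_{i-1}<x\le w_1+\dots+w_i$, $f_{\mathbf w}(x+m)=f_{\mathbf w}(x)+r$. For $f=\mathcal A_{\mathbf w}(\mathsf D,\Upsilon)$ there is a unique $\sigma\in\widetilde S_m$ with $f=f_{\mathbf w}\circ\sigma$ and $\sigma^{ -1}(a)<\sigma^{ -1}(b)$ whenever $a<b$, $f_{\mathbf w}(a)=f_{\mathbf w}(b)$; $\mathrm{std}(\mathsf D,\Upsilon)=\mathcal A^{ -1}(\sigma)$. For $(\mathsf D,\varphi)\in\mathrm{PF}_{m,n}$, $\omega=\mathcal A(\mathsf D,\varphi)$, $\mathrm{codinv}(\mathsf D,\varphi)=|\{(i,h)\in\{1,\dots,m\}\times\{1,\dots,n\}:\omega(i+h)<\omega(i)\}|$; $\mathrm{codinv}(\mathsf D,\Upsilon):=\mathrm{codinv}(\mathrm{std}(\mathsf D,\Upsilon))$. Boxes: a box is a unit lattice square, identified with its upper right corner. An area box of $\mathsf D$ is a box lying entirely between $\mathsf D$ and the line $mx+ny=mn$. A path box of $\mathsf D$ is a box whose right side is a vertical step of $\mathsf D$; for a path box $b$, $\Upsilon(b)$ is the value of $\Upsilon$ on that vertical step. The laser ray $\ell_b$ of a box $b$ is the line of slope $-m/n$ through its upper right corner. For an area box $b$, $\mathrm{codinv}_b(\mathsf D,\Upsilon)$ is the number of vertical steps $v$ of $\mathsf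 D$ intersected by $\ell_b$; for a path box $b$, $\mathrm{codinv}_b(\mathsf D,\Upsilon)$ is the number of vertical steps $v$ intersected by $\ell_b$ with $\Upsilon(b)<\Upsilon(v)$. -}

module Defs where

open import Data.Nat as ℕ using (ℕ; zero; suc; _∸_)
open import Data.Nat.Coprimality using (Coprime) public
open import Data.Integer as ℤ using (ℤ; +_)
open import Data.Fin using (Fin; toℕ)
open import Data.List using (List; map; foldr; allFin; upTo; filter; length; concatMap)
open import Data.Product using (Σ; ∃; _×_; _,_; proj₁; proj₂)
open import Data.Bool using (if_then_else_)
open import Relation.Nullary.Decidable using (Dec; _×-dec_; ⌊_⌋)
open import Relation.Binary.PropositionalEquality using (_≡_)

oneTo : ℕ → List ℕ
oneTo k = map suc (upTo k)

sumℕ : List ℕ → ℕ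
sumℕ = foldr ℕ._+_ 0

sumℤ : List ℤ → ℤ
sumℤ = foldr ℤ._+_ (+ 0)

-- A lattice path from (0,m) to (n,0) with unit south/east steps is
-- recorded by the x-coordinates a_0 ≤ ... ≤ a_{m-1} of its vertical
-- steps v_0,...,v_{m-1} (top to bottom); v_j has top endpoint
-- (a_j , m - j).  Staying weakly below mx+ny=mn amounts to
-- m*a_j + n*(m-j) ≤ m*n for every j (the top endpoints of the vertical
-- steps are the rightmost path points of each height).

record DyckPath (m n : ℕ) : Set where
  field
    a      : Fin m → ℕ
    mono   : ∀ (i j : Fin m) → toℕ i ℕ.≤ toℕ j → a i ℕ.≤ a j
    below  : ∀ (j : Fin m) → m ℕ.* a j ℕ.+ n ℕ.* (m ∸ toℕ j) ℕ.≤ m ℕ.* n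
open DyckPath public

γ : (m n : ℕ) → ℤ → ℤ → ℤ
γ m n x y = + (m ℕ.* n) ℤ.- + m ℤ.* x ℤ.- + n ℤ.* y

γv : ∀ {m n} → DyckPath m n → Fin m → ℤ
γv {m} {n} D j = γ m n (+ a D j) (+ (m ∸ toℕ j))

Consecutive : ∀ {m n} → DyckPath m n → Fin m → Fin m → Set
Consecutive D j j' = (toℕ j' ≡ suc (toℕ j)) × (a D j ≡ a D j')

record SSPF (m n r : ℕ) : Set where
  field
    D       : DyckPath m n
    Υ       : Fin m → ℕ
    Υ-range : ∀ j → 1 ℕ.≤ Υ j × Υ j ℕ.≤ r
    Υ-cons  : ∀ j j' → Consecutive D j j' → Υ j ℕ.≤ Υ j'
open SSPF public

weight : ∀ {m n r} → SSPF m n r → ℕ → ℕ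
weight {m} P i = length (filter (λ j → Υ P j ℕ.≟ i) (allFin m))

Wsum : ∀ {m n r} → SSPF m n r → ℕ → ℕ
Wsum P i = sumℕ (map (weight P) (oneTo i))

FW : ∀ {m n r} → SSPF m n r → ℤ → ℤ → Set
FW {m} {n} {r} P x c =
  Σ ℤ λ p → Σ ℕ λ x' → Σ ℕ λ i →
    (1 ℕ.≤ x' × x' ℕ.≤ m) × (1 ℕ.≤ i × i ℕ.≤ r) ×
    (Wsum P (i ∸ 1) ℕ.< x' × x' ℕ.≤ Wsum P i) ×
    (x ≡ + x' ℤ.+ p ℤ.* + m) × (c ≡ + i ℤ.+ p ℤ.* + r)

Ftilde : ∀ {m n r} → SSPF m n r → ℤ → ℤ → Set
Ftilde {m} {n} {r} P y c =
  Σ (Fin m) λ j → Σ ℤ λ p →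
    (y ≡ γv (D P) j ℤ.+ p ℤ.* + m) × (c ≡ + Υ P j ℤ.+ p ℤ.* + r)

ShiftK : ∀ {m n r} → SSPF m n r → ℤ → Set
ShiftK {m} P k =
  sumℤ (map (λ j → γv (D P) j ℤ.- + suc (toℕ j)) (allFin m)) ≡ k ℤ.* + m

FA : ∀ {m n r} → SSPF m n r → ℤ → ℤ → ℤ → Set
FA P k x c = Ftilde P (x ℤ.+ k) c

record IsAffinePerm (m : ℕ) (σ τ : ℤ → ℤ) : Set where
  field
    rightInv : ∀ x → σ (τ x) ≡ x
    leftInv  : ∀ x → τ (σ x) ≡ x
    periodic : ∀ x → σ (x ℤ.+ + m) ≡ σ x ℤ.+ + m
    window   : sumℤ (map (λ i → σ (+ i)) (oneTo m)) ≡ + ((m ℕ.* suc m) ℕ./ 2)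

record IsStdPerm {m n r} (P : SSPF m n r) (k : ℤ) (σ τ : ℤ → ℤ) : Set where
  field
    affine : IsAffinePerm m σ τ
    factor : ∀ x c → FA P k x c → FW P (σ x) c
    order  : ∀ a b c → a ℤ.< b → FW P a c → FW P b c → τ a ℤ.< τ b

-- codinv of the parking function A⁻¹(ω), computed from ω = A(D,φ):
-- |{(i,h) ∈ [1,m]×[1,n] : ω(i+h) < ω(i)}|
codinvω : (m n : ℕ) → (ℤ → ℤ) → ℕ
codinvω m n ω =
  length (filter (λ ih → ω (+ (proj₁ ih ℕ.+ proj₂ ih)) ℤ.<? ω (+ proj₁ ih))
    (concatMap (λ i → map (λ h → (i , h)) (oneTo n)) (oneTo m)))

-- A box is identified with its upper right corner (x,y); the laser line
-- through it is {(x',y') : γ(x',y') = γ(x,y)}.  It meets the vertical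
-- step v_j (segment from (a_j,m-j) to (a_j,m-j-1)) iff
-- γ(v_j) ≤ γ(x,y) ≤ γ(v_j) + n.

Hits : ∀ {m n} → DyckPath m n → ℤ → Fin m → Set
Hits {m} {n} D g j = (γv D j ℤ.≤ g) × (g ℤ.≤ γv D j ℤ.+ + n)

hits? : ∀ {m n} (D : DyckPath m n) g j → Dec (Hits D g j)
hits? {m} {n} D g j = (γv D j ℤ.≤? g) ×-dec (g ℤ.≤? γv D j ℤ.+ + n)

-- The box with upper right corner (x, m - j) (the row of v_j) is an area
-- box iff it lies right of v_j (a_j ≤ x - 1) and below the line
-- (m x + n (m-j) ≤ m n).  Every area box has 1 ≤ x ≤ n and lies in the
-- row of a unique vertical step.
IsAreaBox : ∀ {m n} → DyckPath m n → Fin m → ℕ → Set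
IsAreaBox {m} {n} D j x =
  (suc (a D j) ℕ.≤ x) × (m ℕ.* x ℕ.+ n ℕ.* (m ∸ toℕ j) ℕ.≤ m ℕ.* n)

isAreaBox? : ∀ {m n} (D : DyckPath m n) j x → Dec (IsAreaBox D j x)
isAreaBox? {m} {n} D j x =
  (suc (a D j) ℕ.≤? x) ×-dec (m ℕ.* x ℕ.+ n ℕ.* (m ∸ toℕ j) ℕ.≤? m ℕ.* n)

codinvArea : ∀ {m n r} → SSPF m n r → Fin m → ℕ → ℕ
codinvArea {m} {n} P j x =
  length (filter (hits? (D P) (γ m n (+ x) (+ (m ∸ toℕ j)))) (allFin m))

codinvPath : ∀ {m n r} → SSPF m n r → Fin m → ℕ
codinvPath {m} P j =
  length (filter (λ v → hits? (D P) (γv (D P) j) v ×-dec (Υ P j ℕ.<? Υ P v)) (allFin m))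

areaSum : ∀ {m n r} → SSPF m n r → ℕ
areaSum {m} {n} P =
  sumℕ (map (λ j → sumℕ (map (λ x → if ⌊ isAreaBox? (D P) j x ⌋ then codinvArea P j x else 0)
                              (oneTo n)))
            (allFin m))

-- Σ over path boxes of codinv_b (one path box per vertical step)
pathSum : ∀ {m n r} → SSPF m n r → ℕ
pathSum {m} P = sumℕ (map (codinvPath P) (allFin m))

-- Since gcd(m, n) = 1 the values γ(v_j) are pairwise incongruent mod m, so every integer is
-- uniquely γ(v_j) + p m and f̃ is a function on ℤ with f̃(y + p m) = f̃(y) + p r.  Standardisation
-- keeps the strict descents of f = f̃(· + k) (f_w is weakly increasing and σ breaks its ties in
-- order), so codinv counts pairs (y, y + h) with 1 ≤ h ≤ n and f̃(y + h) < f̃(y), y ranging over m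
-- consecutive integers; by periodicity y may range over the γ(v) instead.  As 1 ≤ Υ ≤ r, writing
-- γ(v) + h = γ(v_i) + p m, the descent f̃(γ(v) + h) < Υ(v) happens iff p < 0, or p = 0 and
-- Υ(v_i) < Υ(v).  In the first case γ(v) + h is the γ-value of an area box in the row of v_i whose
-- laser ray meets v; in the second, the laser ray of the path box of v_i meets v, and Υ(v_i) < Υ(v).

{-# OPTIONS --safe #-}
module Submission where

open import Defs
open import Data.Nat as ℕ using (ℕ; zero; suc; z≤n; s≤s)
import Data.Nat.Properties as ℕP
open import Data.Nat.Divisibility using (divides; ∣⇒≤)
open import Data.Nat.Coprimality using (coprime-divisor)
open import Data.Integer as ℤ using (ℤ; +_; -[1+_]; ∣_∣; 0ℤ; 1ℤ)
import Data.Integer.Properties as ℤP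
open import Data.Integer.DivMod using (_%ℕ_; _/ℕ_; a≡a%ℕn+[a/ℕn]*n; n%ℕd<d)
open import Data.Integer.Tactic.RingSolver using (solve-∀)
open import Data.Fin using (Fin; zero; suc; toℕ; fromℕ<; punchOut)
import Data.Fin.Properties as FinP
open import Data.List using (List; []; _∷_; map; allFin; upTo; filter; length; concatMap; _++_)
open import Data.List.Properties using (map-cong; map-∘; map-tabulate; upTo-∷ʳ)
open import Data.Product using (Σ; ∃; _×_; _,_; proj₁; proj₂)
open import Data.Sum using (_⊎_; inj₁; inj₂)
open import Data.Bool using (if_then_else_)
open import Data.Empty using (⊥; ⊥-elim)
open import Function using (_∘_)
open import Relation.Nullary using (Dec; yes; no; ¬_)
open import Relation.Nullary.Decidable using (_×-dec_; ⌊_⌋)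
open import Relation.Unary using (Pred; Decidable)
open import Relation.Binary.Definitions using (Tri; tri<; tri≈; tri>)
open import Relation.Binary.PropositionalEquality
open import Algebra.Properties.CommutativeSemigroup ℕP.+-commutativeSemigroup using (interchange)

𝟙 : ∀ {a} {A : Set a} → Dec A → ℕ
𝟙 (yes _) = 1
𝟙 (no _)  = 0

∑ : ∀ {a} {A : Set a} → List A → (A → ℕ) → ℕ
∑ xs f = sumℕ (map f xs)

module _ {a} {A : Set a} where
  open import Data.Nat using (_+_; _*_)

  ∑-cong : ∀ (xs : List A) {f g : A → ℕ} → (∀ x → f x ≡ g x) → ∑ xs f ≡ ∑ xs g
  ∑-cong xs eq = cong sumℕ (map-cong eq xs)

  ∑-+ : ∀ (xs : List A) f g → ∑ xs (λ x → f x + g x) ≡ ∑ xs f + ∑ xs g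
  ∑-+ []       f g = refl
  ∑-+ (x ∷ xs) f g =
    trans (cong (λ s → f x + g x + s) (∑-+ xs f g)) (interchange (f x) (g x) (∑ xs f) (∑ xs g))

  ∑-*ˡ : ∀ (xs : List A) c f → ∑ xs (λ x → c * f x) ≡ c * ∑ xs f
  ∑-*ˡ []       c f = sym (ℕP.*-zeroʳ c)
  ∑-*ˡ (x ∷ xs) c f =
    trans (cong (λ s → c * f x + s) (∑-*ˡ xs c f)) (sym (ℕP.*-distribˡ-+ c (f x) (∑ xs f)))

  ∑-zero : ∀ (xs : List A) f → (∀ x → f x ≡ 0) → ∑ xs f ≡ 0
  ∑-zero []       f f≡0 = refl
  ∑-zero (x ∷ xs) f f≡0 = cong₂ _+_ (f≡0 x) (∑-zero xs f f≡0)

  ∑-++ : ∀ (xs ys : List A) f → ∑ (xs ++ ys) f ≡ ∑ xs f + ∑ ys f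
  ∑-++ []       ys f = refl
  ∑-++ (x ∷ xs) ys f =
    trans (cong (λ s → f x + s) (∑-++ xs ys f)) (sym (ℕP.+-assoc (f x) (∑ xs f) (∑ ys f)))

  length-filter≡∑𝟙 : ∀ {p} {P : Pred A p} (P? : Decidable P) (xs : List A) →
                     length (filter P? xs) ≡ ∑ xs (λ x → 𝟙 (P? x))
  length-filter≡∑𝟙 P? []       = refl
  length-filter≡∑𝟙 P? (x ∷ xs) with P? x
  ... | yes _ = cong suc (length-filter≡∑𝟙 P? xs)
  ... | no  _ = length-filter≡∑𝟙 P? xs

module _ {a b} {A : Set a} {B : Set b} where

  ∑-swap : ∀ (xs : List A) (ys : List B) (f : A → B → ℕ) →
           ∑ xs (λ x → ∑ ys (f x)) ≡ ∑ ys (λ y → ∑ xs (λ x → f x y))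
  ∑-swap []       ys f = sym (∑-zero ys _ (λ _ → refl))
  ∑-swap (x ∷ xs) ys f =
    trans (cong (∑ ys (f x) ℕ.+_) (∑-swap xs ys f)) (sym (∑-+ ys (f x) (λ y → ∑ xs (λ x → f x y))))

  ∑-map : ∀ (xs : List A) (g : A → B) f → ∑ (map g xs) f ≡ ∑ xs (λ x → f (g x))
  ∑-map xs g f = cong sumℕ (sym (map-∘ xs))

  ∑-concatMap : ∀ (xs : List A) (g : A → List B) f →
                ∑ (concatMap g xs) f ≡ ∑ xs (λ x → ∑ (g x) f)
  ∑-concatMap []       g f = refl
  ∑-concatMap (x ∷ xs) g f =
    trans (∑-++ (g x) (concatMap g xs) f) (cong (∑ (g x) f ℕ.+_) (∑-concatMap xs g f))

  𝟙-cong : (A? : Dec A) (B? : Dec B) → (A → B) → (B → A) → 𝟙 A? ≡ 𝟙 B?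
  𝟙-cong (yes _) (yes _) _   _   = refl
  𝟙-cong (yes x) (no ¬y) A→B _   = ⊥-elim (¬y (A→B x))
  𝟙-cong (no ¬x) (yes y) _   B→A = ⊥-elim (¬x (B→A y))
  𝟙-cong (no _)  (no _)  _   _   = refl

  𝟙*𝟙≡0 : (A? : Dec A) (B? : Dec B) → (A → B → ⊥) → 𝟙 A? ℕ.* 𝟙 B? ≡ 0
  𝟙*𝟙≡0 (yes x) (yes y) ¬A×B = ⊥-elim (¬A×B x y)
  𝟙*𝟙≡0 (yes _) (no _)  _    = refl
  𝟙*𝟙≡0 (no _)  _       _    = refl

module _ {a} {A : Set a} where

  𝟙-yes : A → (A? : Dec A) → 𝟙 A? ≡ 1
  𝟙-yes _ (yes _) = refl
  𝟙-yes x (no ¬x) = ⊥-elim (¬x x)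

  𝟙-no : ¬ A → (A? : Dec A) → 𝟙 A? ≡ 0
  𝟙-no ¬x (yes x) = ⊥-elim (¬x x)
  𝟙-no _  (no _)  = refl

  if-then-else-0≡𝟙* : (A? : Dec A) (c : ℕ) → (if ⌊ A? ⌋ then c else 0) ≡ 𝟙 A? ℕ.* c
  if-then-else-0≡𝟙* (yes _) c = sym (ℕP.+-identityʳ c)
  if-then-else-0≡𝟙* (no _)  c = refl

∑-allFin-suc : ∀ {m} (f : Fin (suc m) → ℕ) → ∑ (allFin (suc m)) f ≡ f zero ℕ.+ ∑ (allFin m) (λ j → f (suc j))
∑-allFin-suc {m} f = cong (f zero ℕ.+_) (trans (cong sumℕ (map-tabulate suc f))
                                           (sym (cong sumℕ (map-tabulate (λ j → j) (λ j → f (suc j))))))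

∑-allFin-single : ∀ {m} (f : Fin m → ℕ) j₀ → (∀ j → j ≢ j₀ → f j ≡ 0) → ∑ (allFin m) f ≡ f j₀
∑-allFin-single {suc m} f zero f≡0 =
  trans (∑-allFin-suc f)
    (trans (cong (f zero ℕ.+_) (∑-zero (allFin m) _ (λ j → f≡0 (suc j) (λ ())))) (ℕP.+-identityʳ _))
∑-allFin-single {suc m} f (suc j₀) f≡0 =
  trans (∑-allFin-suc f)
    (cong₂ ℕ._+_ (f≡0 zero (λ ()))
       (∑-allFin-single (λ j → f (suc j)) j₀ (λ j j≢j₀ → f≡0 (suc j) (j≢j₀ ∘ FinP.suc-injective))))

∑-upTo-suc : ∀ N f → ∑ (upTo (suc N)) f ≡ ∑ (upTo N) f ℕ.+ f N
∑-upTo-suc N f =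
  trans (cong (λ l → ∑ l f) (sym (upTo-∷ʳ N)))
    (trans (∑-++ (upTo N) (N ∷ []) f) (cong (∑ (upTo N) f ℕ.+_) (ℕP.+-identityʳ (f N))))

∑-upTo-zero : ∀ N f → (∀ t → t ℕ.< N → f t ≡ 0) → ∑ (upTo N) f ≡ 0
∑-upTo-zero zero    f f≡0 = refl
∑-upTo-zero (suc N) f f≡0 =
  trans (∑-upTo-suc N f)
    (cong₂ ℕ._+_ (∑-upTo-zero N f (λ t t<N → f≡0 t (ℕP.m<n⇒m<1+n t<N))) (f≡0 N ℕP.≤-refl))

∑-upTo-single : ∀ N f t₀ → t₀ ℕ.< N → (∀ t → t ℕ.< N → t ≢ t₀ → f t ≡ 0) → ∑ (upTo N) f ≡ f t₀
∑-upTo-single (suc N) f t₀ t₀<1+N f≡0 with t₀ ℕP.≟ N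
... | yes refl =
  trans (∑-upTo-suc N f)
    (cong (ℕ._+ f t₀) (∑-upTo-zero N f (λ t t<N → f≡0 t (ℕP.m<n⇒m<1+n t<N) (λ t≡N → ℕP.<-irrefl t≡N t<N))))
... | no t₀≢N =
  trans (∑-upTo-suc N f)
    (trans (cong₂ ℕ._+_ (∑-upTo-single N f t₀ (ℕP.≤∧≢⇒< (ℕP.≤-pred t₀<1+N) t₀≢N)
                                        (λ t t<N → f≡0 t (ℕP.m<n⇒m<1+n t<N)))
                        (f≡0 N ℕP.≤-refl (t₀≢N ∘ sym)))
           (ℕP.+-identityʳ _))

∑-oneTo-zero : ∀ N f → (∀ h → 1 ℕ.≤ h → h ℕ.≤ N → f h ≡ 0) → ∑ (oneTo N) f ≡ 0
∑-oneTo-zero N f f≡0 =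
  trans (∑-map (upTo N) suc f) (∑-upTo-zero N (f ∘ suc) (λ t t<N → f≡0 (suc t) (s≤s z≤n) t<N))

∑-oneTo-single : ∀ N f h₀ → 1 ℕ.≤ h₀ → h₀ ℕ.≤ N → (∀ h → 1 ℕ.≤ h → h ℕ.≤ N → h ≢ h₀ → f h ≡ 0) →
                 ∑ (oneTo N) f ≡ f h₀
∑-oneTo-single N f (suc t₀) _ h₀≤N f≡0 =
  trans (∑-map (upTo N) suc f)
    (∑-upTo-single N (f ∘ suc) t₀ h₀≤N (λ t t<N t≢t₀ → f≡0 (suc t) (s≤s z≤n) t<N (t≢t₀ ∘ ℕP.suc-injective)))

∑-oneTo-cong : ∀ N {f g : ℕ → ℕ} → (∀ h → f (suc h) ≡ g (suc h)) → ∑ (oneTo N) f ≡ ∑ (oneTo N) g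
∑-oneTo-cong N {f} {g} eq = trans (∑-map (upTo N) suc f) (trans (∑-cong (upTo N) eq) (sym (∑-map (upTo N) suc g)))

Fin-injective⇒surjective : ∀ {N} (f : Fin N → Fin N) → (∀ {i j} → f i ≡ f j → i ≡ j) → ∀ t → ∃ λ j → f j ≡ t
Fin-injective⇒surjective {suc N} f f-inj t with FinP.any? (λ j → f j FinP.≟ t)
... | yes hit = hit
... | no ¬hit = ⊥-elim (ℕP.<-irrefl refl (FinP.injective⇒≤ {f = g} g-inj))
  where
    g : Fin (suc N) → Fin N
    g j = punchOut {i = t} {j = f j} (λ t≡fj → ¬hit (j , sym t≡fj))
    g-inj : ∀ {i j} → g i ≡ g j → i ≡ j
    g-inj {i} {j} gi≡gj =
      f-inj (FinP.punchOut-injective (λ e → ¬hit (i , sym e)) (λ e → ¬hit (j , sym e)) gi≡gj)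

module _ where
  open import Data.Integer using (_+_; _-_; _*_; -_; _≤_; _<_; _≤?_; _≟_)

  +-cancelˡ-≡ : ∀ i {j k} → i + j ≡ i + k → j ≡ k
  +-cancelˡ-≡ i {j} {k} eq = trans (lemma i j) (trans (cong (_- i) eq) (sym (lemma i k)))
    where lemma : ∀ a b → b ≡ (a + b) - a
          lemma = solve-∀

  +-cancelˡ-≤ : ∀ i {j k} → i + j ≤ i + k → j ≤ k
  +-cancelˡ-≤ i {j} {k} le = subst₂ _≤_ (lemma i j) (lemma i k) (ℤP.+-monoʳ-≤ (- i) le)
    where lemma : ∀ a b → - a + (a + b) ≡ b
          lemma = solve-∀

  +-cancelʳ-< : ∀ {i j} k → i + k < j + k → i < j
  +-cancelʳ-< {i} {j} k lt = subst₂ _<_ (lemma i k) (lemma j k) (ℤP.+-monoˡ-< (- k) lt)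
    where lemma : ∀ a c → a + c + - c ≡ a
          lemma = solve-∀

  ≤⇒≡+∣-∣ : ∀ {i j} → i ≤ j → j ≡ i + + ∣ j - i ∣
  ≤⇒≡+∣-∣ {i} {j} i≤j = trans (lemma i j) (cong (λ d → i + d) (sym (ℤP.0≤i⇒+∣i∣≡i (ℤP.i≤j⇒0≤j-i i≤j))))
    where lemma : ∀ a b → b ≡ a + (b - a)
          lemma = solve-∀

  +-∸ : ∀ {a b} → b ℕ.≤ a → + (a ℕ.∸ b) ≡ + a - + b
  +-∸ {a} {b} b≤a = sym (trans (ℤP.m-n≡m⊖n a b) (ℤP.⊖-≥ b≤a))

  +c+p*N<+c′+q*N : ∀ {c c′ N : ℕ} {p q : ℤ} → c ℕ.≤ N → 1 ℕ.≤ c′ → p < q → + c + p * + N < + c′ + q * + N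
  +c+p*N<+c′+q*N {c} {c′} {N} {p} {q} c≤N 1≤c′ p<q = begin-strict
    + c + p * + N   ≤⟨ ℤP.+-monoˡ-≤ (p * + N) (ℤ.+≤+ c≤N) ⟩
    + N + p * + N   ≡⟨ ℤP.suc-* p (+ N) ⟨
    ℤ.suc p * + N   ≤⟨ ℤP.*-monoʳ-≤-nonNeg (+ N) (ℤP.i<j⇒suc[i]≤j p<q) ⟩
    q * + N         ≡⟨ ℤP.+-identityˡ (q * + N) ⟨
    0ℤ + q * + N    <⟨ ℤP.+-monoˡ-< (q * + N) (ℤ.+<+ 1≤c′) ⟩
    + c′ + q * + N  ∎
    where open ℤP.≤-Reasoning

  ∑-oneTo-𝟙[b+h≡g] : ∀ n (b g : ℤ) → g ≢ b →
                     ∑ (oneTo n) (λ h → 𝟙 (b + + h ≟ g)) ≡ 𝟙 ((b ≤? g) ×-dec (g ≤? b + + n))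
  ∑-oneTo-𝟙[b+h≡g] n b g g≢b with (b ≤? g) ×-dec (g ≤? b + + n)
  ... | yes (b≤g , g≤b+n) =
    trans (∑-oneTo-single n _ t 1≤t t≤n others) (𝟙-yes (sym g≡b+t) (b + + t ≟ g))
    where
      t : ℕ
      t = ∣ g - b ∣
      g≡b+t : g ≡ b + + t
      g≡b+t = ≤⇒≡+∣-∣ b≤g
      1≤t : 1 ℕ.≤ t
      1≤t with t in t≡
      ... | zero  = ⊥-elim (g≢b (trans g≡b+t (trans (cong (λ z → b + + z) t≡) (ℤP.+-identityʳ b))))
      ... | suc _ = s≤s z≤n
      t≤n : t ℕ.≤ n
      t≤n = ℤP.drop‿+≤+ (+-cancelˡ-≤ b (subst (_≤ b + + n) g≡b+t g≤b+n))
      others : ∀ h → 1 ℕ.≤ h → h ℕ.≤ n → h ≢ t → 𝟙 (b + + h ≟ g) ≡ 0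
      others h _ _ h≢t = 𝟙-no (λ b+h≡g → h≢t (ℤP.+-injective (+-cancelˡ-≡ b (trans b+h≡g g≡b+t)))) (b + + h ≟ g)
  ... | no ¬hit = ∑-oneTo-zero n _ (λ h _ h≤n → 𝟙-no (λ b+h≡g → ¬hit
          ( subst (b ≤_) b+h≡g (ℤP.i≤i+j b (+ h))
          , subst (_≤ b + + n) b+h≡g (ℤP.+-monoʳ-≤ b (ℤ.+≤+ h≤n)))) (b + + h ≟ g))

module CompleteResidueSystem
  (m : ℕ) {{m≢0 : ℕ.NonZero m}} (G : Fin m → ℤ)
  (G-injective-mod : ∀ j j′ p p′ → G j ℤ.+ p ℤ.* + m ≡ G j′ ℤ.+ p′ ℤ.* + m → j ≡ j′ × p ≡ p′)
  where

  open import Data.Integer using (_+_; _-_; _*_; -_; _≤_; _<_)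

  residue : ℤ → Fin m
  residue y = fromℕ< (n%ℕd<d y m)

  toℕ-residue : ∀ y → toℕ (residue y) ≡ y %ℕ m
  toℕ-residue y = FinP.toℕ-fromℕ< (n%ℕd<d y m)

  subtract-quotient : ∀ y → y + (- (y /ℕ m)) * + m ≡ + (y %ℕ m)
  subtract-quotient y = trans (cong (λ z → z + (- (y /ℕ m)) * + m) (a≡a%ℕn+[a/ℕn]*n y m))
                              (lemma (+ (y %ℕ m)) (y /ℕ m) (+ m))
    where lemma : ∀ t q M → t + q * M + (- q) * M ≡ t
          lemma = solve-∀

  residue-G-injective : ∀ {i j} → residue (G i) ≡ residue (G j) → i ≡ j
  residue-G-injective {i} {j} eq = proj₁ (G-injective-mod i j (- (G i /ℕ m)) (- (G j /ℕ m))
    (trans (subtract-quotient (G i))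
      (trans (cong +_ (trans (sym (toℕ-residue (G i))) (trans (cong toℕ eq) (toℕ-residue (G j)))))
        (sym (subtract-quotient (G j))))))

  decompose : ∀ y → Σ (Fin m) λ j → Σ ℤ λ p → y ≡ G j + p * + m
  decompose y =
    j , y /ℕ m - G j /ℕ m , trans (a≡a%ℕn+[a/ℕn]*n y m) (lemma (+ (y %ℕ m)) (G j) (y /ℕ m) (G j /ℕ m) Gj≡)
    where
      j : Fin m
      j = proj₁ (Fin-injective⇒surjective (residue ∘ G) residue-G-injective (residue y))
      Gj≡ : G j ≡ + (y %ℕ m) + (G j /ℕ m) * + m
      Gj≡ = trans (a≡a%ℕn+[a/ℕn]*n (G j) m)
        (cong (λ t → + t + (G j /ℕ m) * + m)
          (trans (sym (toℕ-residue (G j)))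
            (trans (cong toℕ (proj₂ (Fin-injective⇒surjective (residue ∘ G) residue-G-injective (residue y))))
              (toℕ-residue y))))
      lemma : ∀ t g qy qg → g ≡ t + qg * + m → t + qy * + m ≡ g + (qy - qg) * + m
      lemma t g qy qg refl = lemma′ t qy qg (+ m)
        where lemma′ : ∀ t qy qg M → t + qy * M ≡ t + qg * M + (qy - qg) * M
              lemma′ = solve-∀

  index : ℤ → Fin m
  index y = proj₁ (decompose y)

  level : ℤ → ℤ
  level y = proj₁ (proj₂ (decompose y))

  decomposition : ∀ y → y ≡ G (index y) + level y * + m
  decomposition y = proj₂ (proj₂ (decompose y))

  decomposition-unique : ∀ y j p → y ≡ G j + p * + m → index y ≡ j × level y ≡ p
  decomposition-unique y j p y≡ = G-injective-mod (index y) j (level y) p (trans (sym (decomposition y)) y≡)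

  index-G : ∀ {y} j → y ≡ G j → index y ≡ j
  index-G {y} j y≡ = proj₁ (decomposition-unique y j 0ℤ (trans y≡ (sym (ℤP.+-identityʳ (G j)))))

  +1+e*m-beyond-window : ∀ {i i₀} e → 1 ℕ.≤ i₀ → i ℕ.≤ m → + i ≢ + i₀ + + suc e * + m
  +1+e*m-beyond-window {i} {i₀} e 1≤i₀ i≤m eq =
    ℕP.<⇒≱ (ℕP.<-≤-trans (ℕP.+-mono-≤ 1≤i₀ (ℕP.m≤m+n m (e ℕ.* m))) (ℕP.≤-reflexive (sym i≡))) i≤m
    where
      i≡ : i ≡ i₀ ℕ.+ suc e ℕ.* m
      i≡ = ℤP.+-injective (trans eq (cong (λ z → + i₀ + z) (sym (ℤP.pos-* (suc e) m))))

  window-congruent⇒≡ : ∀ {i i₀} e → 1 ℕ.≤ i → i ℕ.≤ m → 1 ℕ.≤ i₀ → i₀ ℕ.≤ m → + i ≡ + i₀ + e * + m → i ≡ i₀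
  window-congruent⇒≡ (+ zero)  _   _   _    _    eq = trans (ℤP.+-injective eq) (ℕP.+-identityʳ _)
  window-congruent⇒≡ (+ suc e) _   i≤m 1≤i₀ _    eq = ⊥-elim (+1+e*m-beyond-window e 1≤i₀ i≤m eq)
  window-congruent⇒≡ -[1+ e ]  1≤i _   _    i₀≤m eq =
    ⊥-elim (+1+e*m-beyond-window e 1≤i i₀≤m (swap (+ _) (+ _) (+ suc e) (+ m) eq))
    where
      swap : ∀ a b c M → a ≡ b + (- c) * M → b ≡ a + c * M
      swap a b c M refl = lemma b c M
        where lemma : ∀ b c M → b ≡ b + (- c) * M + c * M
              lemma = solve-∀

  -- The only such i is 1 + (G j - k - 1) mod m.
  window-meets-class-once : ∀ k j → ∑ (oneTo m) (λ i → 𝟙 (index (+ i + k) FinP.≟ j)) ≡ 1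
  window-meets-class-once k j =
    trans (∑-oneTo-single m _ (suc t) (s≤s z≤n) (n%ℕd<d g m) others) (𝟙-yes hit (index (+ suc t + k) FinP.≟ j))
    where
      g : ℤ
      g = G j - k - 1ℤ
      t : ℕ
      t = g %ℕ m
      q : ℤ
      q = g /ℕ m
      t≡ : + t ≡ g - q * + m
      t≡ = trans (lemma (+ t) q (+ m)) (cong (_- q * + m) (sym (a≡a%ℕn+[a/ℕn]*n g m)))
        where lemma : ∀ t q M → t ≡ t + q * M - q * M
              lemma = solve-∀
      1+t+k≡ : + suc t + k ≡ G j + (- q) * + m
      1+t+k≡ = trans (cong (λ z → 1ℤ + z + k) t≡) (lemma (G j) k q (+ m))
        where lemma : ∀ Gj k q M → 1ℤ + (Gj - k - 1ℤ - q * M) + k ≡ Gj + (- q) * M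
              lemma = solve-∀
      hit : index (+ suc t + k) ≡ j
      hit = proj₁ (decomposition-unique (+ suc t + k) j (- q) 1+t+k≡)
      difference : ∀ a b k g p p′ → a + k ≡ g + p * + m → b + k ≡ g + p′ * + m → a ≡ b + (p - p′) * + m
      difference a b k g p p′ e e′ = begin
        a                                 ≡⟨ cancel a k ⟩
        a + k - k                         ≡⟨ cong (_- k) e ⟩
        g + p * + m - k                   ≡⟨ lemma g p p′ (+ m) k ⟩
        g + p′ * + m - k + (p - p′) * + m ≡⟨ cong (λ z → z - k + (p - p′) * + m) (sym e′) ⟩
        b + k - k + (p - p′) * + m        ≡⟨ cong (_+ (p - p′) * + m) (sym (cancel b k)) ⟩
        b + (p - p′) * + m                ∎
        where
          open ≡-Reasoning
          cancel : ∀ a k → a ≡ a + k - k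
          cancel = solve-∀
          lemma : ∀ g p p′ M k → g + p * M - k ≡ g + p′ * M - k + (p - p′) * M
          lemma = solve-∀
      others : ∀ i → 1 ℕ.≤ i → i ℕ.≤ m → i ≢ suc t → 𝟙 (index (+ i + k) FinP.≟ j) ≡ 0
      others i 1≤i i≤m i≢1+t = 𝟙-no (λ index≡j → i≢1+t
        (window-congruent⇒≡ (level (+ i + k) - (- q)) 1≤i i≤m (s≤s z≤n) (n%ℕd<d g m)
          (difference (+ i) (+ suc t) k (G j) (level (+ i + k)) (- q)
             (trans (decomposition (+ i + k)) (cong (λ z → G z + level (+ i + k) * + m) index≡j)) 1+t+k≡)))
        (index (+ i + k) FinP.≟ j)

  ∑-window≡∑-G : (F : ℤ → ℕ) → (∀ y q → F (y + q * + m) ≡ F y) → ∀ k →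
                 ∑ (oneTo m) (λ i → F (+ i + k)) ≡ ∑ (allFin m) (F ∘ G)
  ∑-window≡∑-G F F-periodic k = begin
    ∑ (oneTo m) (λ i → F (+ i + k))
      ≡⟨ ∑-cong (oneTo m) (λ i → spread (+ i + k)) ⟩
    ∑ (oneTo m) (λ i → ∑ (allFin m) (λ j → F (G j) ℕ.* 𝟙 (index (+ i + k) FinP.≟ j)))
      ≡⟨ ∑-swap (oneTo m) (allFin m) _ ⟩
    ∑ (allFin m) (λ j → ∑ (oneTo m) (λ i → F (G j) ℕ.* 𝟙 (index (+ i + k) FinP.≟ j)))
      ≡⟨ ∑-cong (allFin m) (λ j → ∑-*ˡ (oneTo m) (F (G j)) _) ⟩
    ∑ (allFin m) (λ j → F (G j) ℕ.* ∑ (oneTo m) (λ i → 𝟙 (index (+ i + k) FinP.≟ j)))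
      ≡⟨ ∑-cong (allFin m) (λ j → trans (cong (F (G j) ℕ.*_) (window-meets-class-once k j)) (ℕP.*-identityʳ _)) ⟩
    ∑ (allFin m) (F ∘ G) ∎
    where
      open ≡-Reasoning
      spread : ∀ y → F y ≡ ∑ (allFin m) (λ j → F (G j) ℕ.* 𝟙 (index y FinP.≟ j))
      spread y = begin
        F y
          ≡⟨ cong F (decomposition y) ⟩
        F (G (index y) + level y * + m)
          ≡⟨ F-periodic (G (index y)) (level y) ⟩
        F (G (index y))
          ≡⟨ ℕP.*-identityʳ _ ⟨
        F (G (index y)) ℕ.* 1
          ≡⟨ cong (F (G (index y)) ℕ.*_) (𝟙-yes refl (index y FinP.≟ index y)) ⟨
        F (G (index y)) ℕ.* 𝟙 (index y FinP.≟ index y)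
          ≡⟨ ∑-allFin-single _ (index y) off-diagonal ⟨
        ∑ (allFin m) (λ j → F (G j) ℕ.* 𝟙 (index y FinP.≟ j)) ∎
        where
          off-diagonal : ∀ j → j ≢ index y → F (G j) ℕ.* 𝟙 (index y FinP.≟ j) ≡ 0
          off-diagonal j j≢ =
            trans (cong (F (G j) ℕ.*_) (𝟙-no (λ e → j≢ (sym e)) (index y FinP.≟ j))) (ℕP.*-zeroʳ (F (G j)))

module _ {m n : ℕ} where
  open import Data.Integer using (_+_; _-_; _*_; -_; _≤_; _<_)

  γ≡mn-[mx+ny] : ∀ x y → γ m n (+ x) (+ y) ≡ + (m ℕ.* n) - + (m ℕ.* x ℕ.+ n ℕ.* y)
  γ≡mn-[mx+ny] x y =
    trans (lemma (+ (m ℕ.* n)) (+ m) (+ n) (+ x) (+ y))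
      (cong₂ (λ u w → + (m ℕ.* n) - (u + w)) (sym (ℤP.pos-* m x)) (sym (ℤP.pos-* n y)))
    where lemma : ∀ MN M N X Y → MN - M * X - N * Y ≡ MN - (M * X + N * Y)
          lemma = solve-∀

  below⇒0≤γ : ∀ x y → m ℕ.* x ℕ.+ n ℕ.* y ℕ.≤ m ℕ.* n → 0ℤ ≤ γ m n (+ x) (+ y)
  below⇒0≤γ x y below = subst (0ℤ ≤_) (sym (γ≡mn-[mx+ny] x y)) (ℤP.i≤j⇒0≤j-i (ℤ.+≤+ below))

  0≤γ⇒below : ∀ x y → 0ℤ ≤ γ m n (+ x) (+ y) → m ℕ.* x ℕ.+ n ℕ.* y ℕ.≤ m ℕ.* n
  0≤γ⇒below x y 0≤γ = ℤP.drop‿+≤+ (ℤP.0≤i-j⇒j≤i (subst (0ℤ ≤_) (γ≡mn-[mx+ny] x y) 0≤γ))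

  module _ (D : DyckPath m n) where

    0≤γv : ∀ j → 0ℤ ≤ γv D j
    0≤γv j = below⇒0≤γ (a D j) (m ℕ.∸ toℕ j) (below D j)

    γ-row : ∀ j x → γ m n (+ x) (+ (m ℕ.∸ toℕ j)) ≡ γv D j + (+ a D j - + x) * + m
    γ-row j x = lemma (+ (m ℕ.* n)) (+ m) (+ n) (+ x) (+ (m ℕ.∸ toℕ j)) (+ a D j)
      where lemma : ∀ MN M N X Y A → MN - M * X - N * Y ≡ (MN - M * A - N * Y) + (A - X) * M
            lemma = solve-∀

    module _ (cop : Coprime m n) where

      +n*[j-j′]≡e*+m⇒j≡j′ : ∀ {j j′ : ℕ} e → j′ ℕ.≤ j → j ℕ.< m → + n * (+ j - + j′) ≡ e * + m → j ≡ j′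
      +n*[j-j′]≡e*+m⇒j≡j′ {j} {j′} e j′≤j j<m eq with j ℕ.∸ j′ in j∸j′≡
      ... | zero  = ℕP.≤-antisym (ℕP.m∸n≡0⇒m≤n j∸j′≡) j′≤j
      ... | suc d = ⊥-elim (ℕP.<⇒≱ j<m (ℕP.≤-trans m≤1+d (ℕP.m∸n≤m j j′)))
        where
          n*[1+d]≡∣e∣*m : n ℕ.* suc d ≡ ∣ e ∣ ℕ.* m
          n*[1+d]≡∣e∣*m = trans (sym (ℤP.abs-* (+ n) (+ suc d)))
            (trans (cong (∣_∣ ∘ (+ n *_)) (trans (cong +_ (sym j∸j′≡)) (+-∸ j′≤j)))
              (trans (cong ∣_∣ eq) (ℤP.abs-* e (+ m))))
          m≤1+d : m ℕ.≤ j ℕ.∸ j′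
          m≤1+d = subst (m ℕ.≤_) (sym j∸j′≡) (∣⇒≤ (coprime-divisor cop (divides ∣ e ∣ n*[1+d]≡∣e∣*m)))

      γv-injective-mod : ∀ j j′ p p′ → γv D j + p * + m ≡ γv D j′ + p′ * + m → j ≡ j′ × p ≡ p′
      γv-injective-mod j j′ p p′ eq = j≡j′ , p≡p′
        where
          e : ℤ
          e = p′ - p + + a D j - + a D j′
          γv≡ : ∀ i → γv D i ≡ + (m ℕ.* n) - + m * + a D i - + n * (+ m - + toℕ i)
          γv≡ i = cong (λ z → + (m ℕ.* n) - + m * + a D i - + n * z) (+-∸ (ℕP.<⇒≤ (FinP.toℕ<n i)))
          identity : ∀ MN M N A A′ J J′ p p′ →
            N * (J - J′) ≡ (p′ - p + A - A′) * M +
                           ((MN - M * A - N * (M - J) + p * M) - (MN - M * A′ - N * (M - J′) + p′ * M))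
          identity = solve-∀
          key : + n * (+ toℕ j - + toℕ j′) ≡ e * + m
          key = trans (identity (+ (m ℕ.* n)) (+ m) (+ n) (+ a D j) (+ a D j′) (+ toℕ j) (+ toℕ j′) p p′)
            (trans (cong (λ z → e * + m + z)
               (trans (cong₂ (λ u v → (u + p * + m) - (v + p′ * + m)) (sym (γv≡ j)) (sym (γv≡ j′)))
                 (trans (cong (λ z → (γv D j + p * + m) - z) (sym eq)) (ℤP.+-inverseʳ (γv D j + p * + m)))))
              (ℤP.+-identityʳ (e * + m)))
          negate : ∀ N J J′ e M → N * (J - J′) ≡ e * M → N * (J′ - J) ≡ (- e) * M
          negate N J J′ e M h = trans (lemma N J J′) (trans (cong -_ h) (lemma′ e M))
            where lemma : ∀ N J J′ → N * (J′ - J) ≡ - (N * (J - J′))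
                  lemma = solve-∀
                  lemma′ : ∀ e M → - (e * M) ≡ (- e) * M
                  lemma′ = solve-∀
          j≡j′ : j ≡ j′
          j≡j′ = FinP.toℕ-injective (case-split (ℕP.≤-total (toℕ j′) (toℕ j)))
            where
              case-split : toℕ j′ ℕ.≤ toℕ j ⊎ toℕ j ℕ.≤ toℕ j′ → toℕ j ≡ toℕ j′
              case-split (inj₁ j′≤j) = +n*[j-j′]≡e*+m⇒j≡j′ e j′≤j (FinP.toℕ<n j) key
              case-split (inj₂ j≤j′) = sym (+n*[j-j′]≡e*+m⇒j≡j′ (- e) j≤j′ (FinP.toℕ<n j′)
                                          (negate (+ n) (+ toℕ j) (+ toℕ j′) e (+ m) key))
          p≡p′ : p ≡ p′
          p≡p′ = ℤP.*-cancelʳ-≡ p p′ (+ m) {{FinP.nonZeroIndex j}}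
                   (+-cancelˡ-≡ (γv D j) (trans eq (cong (λ z → γv D z + p′ * + m) (sym j≡j′))))

module _ {m n r : ℕ} (P : SSPF m n r) where
  open import Data.Integer using (_+_; _*_; _≤_; _<_)

  Wsum-suc : ∀ t → Wsum P (suc t) ≡ Wsum P t ℕ.+ weight P (suc t)
  Wsum-suc t =
    trans (∑-map (upTo (suc t)) suc (weight P))
      (trans (∑-upTo-suc t (weight P ∘ suc)) (cong (ℕ._+ weight P (suc t)) (sym (∑-map (upTo t) suc (weight P)))))

  Wsum-mono : ∀ {s t} → s ℕ.≤ t → Wsum P s ℕ.≤ Wsum P t
  Wsum-mono {s} s≤t = go (ℕP.≤⇒≤′ s≤t)
    where
      go : ∀ {t} → s ℕ.≤′ t → Wsum P s ℕ.≤ Wsum P t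
      go ℕ.≤′-refl = ℕP.≤-refl
      go (ℕ.≤′-step {t} s≤′t) =
        ℕP.≤-trans (go s≤′t) (subst (Wsum P t ℕ.≤_) (sym (Wsum-suc t)) (ℕP.m≤m+n (Wsum P t) _))

  FW-monotone : ∀ {a b c c′} → a < b → FW P a c → FW P b c′ → c ≤ c′
  FW-monotone a<b (p , x , i , (1≤x , x≤m) , (1≤i , i≤r) , (W<x , x≤W) , refl , refl)
                  (q , y , i′ , (1≤y , y≤m) , (1≤i′ , i′≤r) , (W<y , y≤W) , refl , refl)
    with ℤP.<-cmp p q
  ... | tri< p<q _ _ = ℤP.<⇒≤ (+c+p*N<+c′+q*N i≤r 1≤i′ p<q)
  ... | tri> _ _ q<p = ⊥-elim (ℤP.<-asym a<b (+c+p*N<+c′+q*N y≤m 1≤x q<p))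
  ... | tri≈ _ refl _ with i ℕP.≤? i′
  ...   | yes i≤i′ = ℤP.+-monoˡ-≤ (p * + r) (ℤ.+≤+ i≤i′)
  ...   | no  i≰i′ = ⊥-elim (ℕP.<-irrefl refl
                        (ℕP.<-≤-trans W<x (ℕP.≤-trans (ℕP.<⇒≤ x<y) (ℕP.≤-trans y≤W (Wsum-mono i′≤i-1)))))
    where
      x<y : x ℕ.< y
      x<y with y ℕP.≤? x
      ... | no  y≰x = ℕP.≰⇒> y≰x
      ... | yes y≤x = ⊥-elim (ℤP.<⇒≱ a<b (ℤP.+-monoˡ-≤ (p * + m) (ℤ.+≤+ y≤x)))
      i′≤i-1 : i′ ℕ.≤ i ℕ.∸ 1
      i′≤i-1 = ℕP.≤-pred (subst (i′ ℕ.<_) (sym (ℕP.suc-pred i {{ℕ.>-nonZero 1≤i}})) (ℕP.≰⇒> i≰i′))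

module Codinversions {m n r : ℕ} {{m≢0 : ℕ.NonZero m}} (cop : Coprime m n) (P : SSPF m n r) where
  open import Data.Integer using (_+_; _-_; _*_; -_; _≤_; _<_; _<?_; _≟_)

  instance
    +m-positive : ℤ.Positive (+ m)
    +m-positive = ℤ.positive (ℤ.+<+ (ℕ.>-nonZero⁻¹ m))

  γᵥ : Fin m → ℤ
  γᵥ = γv (D P)

  open CompleteResidueSystem m γᵥ (γv-injective-mod (D P) cop) public

  f̃ : ℤ → ℤ
  f̃ y = + Υ P (index y) + level y * + r

  f̃-graph : ∀ y → Ftilde P y (f̃ y)
  f̃-graph y = index y , level y , decomposition y , refl

  f̃-periodic : ∀ y q → f̃ (y + q * + m) ≡ f̃ y + q * + r
  f̃-periodic y q =
    trans (cong₂ (λ j p → + Υ P j + p * + r) (proj₁ unique) (proj₂ unique))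
          (lemma (+ Υ P (index y)) (level y) q (+ r))
    where
      shifted : y + q * + m ≡ γᵥ (index y) + (level y + q) * + m
      shifted = trans (cong (λ z → z + q * + m) (decomposition y)) (lemma′ (γᵥ (index y)) (level y) q (+ m))
        where lemma′ : ∀ g p q M → g + p * M + q * M ≡ g + (p + q) * M
              lemma′ = solve-∀
      unique : index (y + q * + m) ≡ index y × level (y + q * + m) ≡ level y + q
      unique = decomposition-unique (y + q * + m) (index y) (level y + q) shifted
      lemma : ∀ u p q R → u + (p + q) * R ≡ u + p * R + q * R
      lemma = solve-∀

  f̃-γᵥ : ∀ v → f̃ (γᵥ v) ≡ + Υ P v
  f̃-γᵥ v =
    trans (cong₂ (λ j p → + Υ P j + p * + r) (proj₁ unique) (proj₂ unique)) (ℤP.+-identityʳ (+ Υ P v))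
    where
      unique : index (γᵥ v) ≡ v × level (γᵥ v) ≡ 0ℤ
      unique = decomposition-unique (γᵥ v) v 0ℤ (sym (ℤP.+-identityʳ (γᵥ v)))

  shift-down : ∀ g {p} → p < 0ℤ → g + p * + m < g
  shift-down g {p} p<0 =
    subst (λ z → g + p * + m < z) (ℤP.+-identityʳ g) (ℤP.+-monoʳ-< g (ℤP.*-monoʳ-<-pos (+ m) p<0))

  shift-up : ∀ g {p} → 0ℤ < p → g < g + p * + m
  shift-up g {p} 0<p =
    subst (λ z → z < g + p * + m) (ℤP.+-identityʳ g) (ℤP.+-monoʳ-< g (ℤP.*-monoʳ-<-pos (+ m) 0<p))

  below-γ? : ∀ g → Dec (g < γᵥ (index g))
  below-γ? g = g <? γᵥ (index g)

  on-γ-smaller? : ∀ g v → Dec (g ≡ γᵥ (index g) × Υ P (index g) ℕ.< Υ P v)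
  on-γ-smaller? g v = (g ≟ γᵥ (index g)) ×-dec (Υ P (index g) ℕ.<? Υ P v)

  -- As 1 ≤ Υ ≤ r, the sign of level g decides f̃ g < Υ v unless level g = 0.
  f̃<Υ-split : ∀ g v → 𝟙 (f̃ g <? + Υ P v) ≡ 𝟙 (below-γ? g) ℕ.+ 𝟙 (on-γ-smaller? g v)
  f̃<Υ-split g v = by-sign (ℤP.<-cmp (level g) 0ℤ)
    where
      by-sign : Tri (level g < 0ℤ) (level g ≡ 0ℤ) (0ℤ < level g) →
                𝟙 (f̃ g <? + Υ P v) ≡ 𝟙 (below-γ? g) ℕ.+ 𝟙 (on-γ-smaller? g v)
      by-sign (tri< level<0 _ _) =
        trans (𝟙-yes f̃<Υ (f̃ g <? + Υ P v))
          (sym (cong₂ ℕ._+_ (𝟙-yes g<γ (below-γ? g))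
                            (𝟙-no (λ (g≡γ , _) → ℤP.<-irrefl g≡γ g<γ) (on-γ-smaller? g v))))
        where
          f̃<Υ : f̃ g < + Υ P v
          f̃<Υ = subst (f̃ g <_) (ℤP.+-identityʳ (+ Υ P v))
                  (+c+p*N<+c′+q*N (proj₂ (Υ-range P (index g))) (proj₁ (Υ-range P v)) level<0)
          g<γ : g < γᵥ (index g)
          g<γ = subst (_< γᵥ (index g)) (sym (decomposition g)) (shift-down (γᵥ (index g)) level<0)
      by-sign (tri≈ _ level≡0 _) =
        trans (𝟙-cong (f̃ g <? + Υ P v) (Υ P (index g) ℕ.<? Υ P v)
                 (λ lt → ℤP.drop‿+<+ (subst (_< + Υ P v) f̃g≡ lt))
                 (λ lt → subst (_< + Υ P v) (sym f̃g≡) (ℤ.+<+ lt)))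
          (sym (cong₂ ℕ._+_ (𝟙-no (ℤP.<-irrefl g≡γ) (below-γ? g))
                            (𝟙-cong (on-γ-smaller? g v) (Υ P (index g) ℕ.<? Υ P v) proj₂ (λ lt → g≡γ , lt))))
        where
          g≡γ : g ≡ γᵥ (index g)
          g≡γ = trans (decomposition g)
                  (trans (cong (λ p → γᵥ (index g) + p * + m) level≡0) (ℤP.+-identityʳ (γᵥ (index g))))
          f̃g≡ : f̃ g ≡ + Υ P (index g)
          f̃g≡ = trans (cong (λ p → + Υ P (index g) + p * + r) level≡0) (ℤP.+-identityʳ (+ Υ P (index g)))
      by-sign (tri> _ _ 0<level) =
        trans (𝟙-no (ℤP.<-asym Υ<f̃) (f̃ g <? + Υ P v))
          (sym (cong₂ ℕ._+_ (𝟙-no (ℤP.<-asym γ<g) (below-γ? g))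
                            (𝟙-no (λ (g≡γ , _) → ℤP.<-irrefl (sym g≡γ) γ<g) (on-γ-smaller? g v))))
        where
          Υ<f̃ : + Υ P v < f̃ g
          Υ<f̃ = subst (_< f̃ g) (ℤP.+-identityʳ (+ Υ P v))
                  (+c+p*N<+c′+q*N (proj₂ (Υ-range P v)) (proj₁ (Υ-range P (index g))) 0<level)
          γ<g : γᵥ (index g) < g
          γ<g = subst (γᵥ (index g) <_) (sym (decomposition g)) (shift-up (γᵥ (index g)) 0<level)

  ∑-rows-below : ∀ g → ∑ (allFin m) (λ i → 𝟙 ((index g FinP.≟ i) ×-dec (g <? γᵥ i))) ≡ 𝟙 (below-γ? g)
  ∑-rows-below g =
    trans (∑-allFin-single _ (index g)
             (λ i i≢ → 𝟙-no (λ (index≡i , _) → i≢ (sym index≡i)) ((index g FinP.≟ i) ×-dec (g <? γᵥ i))))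
          (𝟙-cong ((index g FinP.≟ index g) ×-dec (g <? γᵥ (index g))) (below-γ? g) proj₂ (λ lt → refl , lt))

  ∑-rows-on : ∀ g v → ∑ (allFin m) (λ i → 𝟙 ((g ≟ γᵥ i) ×-dec (Υ P i ℕ.<? Υ P v))) ≡ 𝟙 (on-γ-smaller? g v)
  ∑-rows-on g v = ∑-allFin-single _ (index g)
    (λ i i≢ → 𝟙-no (λ (g≡γ , _) → i≢ (sym (index-G i g≡γ))) ((g ≟ γᵥ i) ×-dec (Υ P i ℕ.<? Υ P v)))

  descents : ℤ → ℕ
  descents y = ∑ (oneTo n) (λ h → 𝟙 (f̃ (y + + h) <? f̃ y))

  descents-periodic : ∀ y q → descents (y + q * + m) ≡ descents y
  descents-periodic y q = ∑-cong (oneTo n) λ h →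
    𝟙-cong (f̃ (y + q * + m + + h) <? f̃ (y + q * + m)) (f̃ (y + + h) <? f̃ y)
      (λ lt → +-cancelʳ-< (q * + r) (subst₂ _<_ (f̃-shifted h) (f̃-periodic y q) lt))
      (λ lt → subst₂ _<_ (sym (f̃-shifted h)) (sym (f̃-periodic y q)) (ℤP.+-monoˡ-< (q * + r) lt))
    where
      f̃-shifted : ∀ h → f̃ (y + q * + m + + h) ≡ f̃ (y + + h) + q * + r
      f̃-shifted h = trans (cong f̃ (lemma y q (+ m) (+ h))) (f̃-periodic (y + + h) q)
        where lemma : ∀ y q M H → y + q * M + H ≡ y + H + q * M
              lemma = solve-∀

  areaCrossings : Fin m → Fin m → ℕ
  areaCrossings i v = ∑ (oneTo n) (λ h → 𝟙 ((index (γᵥ v + + h) FinP.≟ i) ×-dec (γᵥ v + + h <? γᵥ i)))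

  pathCrossings : Fin m → Fin m → ℕ
  pathCrossings i v = ∑ (oneTo n) (λ h → 𝟙 ((γᵥ v + + h ≟ γᵥ i) ×-dec (Υ P i ℕ.<? Υ P v)))

  descents-γᵥ : ∀ v → descents (γᵥ v) ≡
                ∑ (allFin m) (λ i → areaCrossings i v) ℕ.+ ∑ (allFin m) (λ i → pathCrossings i v)
  descents-γᵥ v = begin
    descents (γᵥ v)
      ≡⟨ ∑-cong (oneTo n) split ⟩
    ∑ (oneTo n) (λ h → ∑ (allFin m) (area h) ℕ.+ ∑ (allFin m) (path h))
      ≡⟨ ∑-+ (oneTo n) (λ h → ∑ (allFin m) (area h)) (λ h → ∑ (allFin m) (path h)) ⟩
    ∑ (oneTo n) (λ h → ∑ (allFin m) (area h)) ℕ.+ ∑ (oneTo n) (λ h → ∑ (allFin m) (path h))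
      ≡⟨ cong₂ ℕ._+_ (∑-swap (oneTo n) (allFin m) area) (∑-swap (oneTo n) (allFin m) path) ⟩
    ∑ (allFin m) (λ i → areaCrossings i v) ℕ.+ ∑ (allFin m) (λ i → pathCrossings i v) ∎
    where
      open ≡-Reasoning
      area : ℕ → Fin m → ℕ
      area h i = 𝟙 ((index (γᵥ v + + h) FinP.≟ i) ×-dec (γᵥ v + + h <? γᵥ i))
      path : ℕ → Fin m → ℕ
      path h i = 𝟙 ((γᵥ v + + h ≟ γᵥ i) ×-dec (Υ P i ℕ.<? Υ P v))
      split : ∀ h → 𝟙 (f̃ (γᵥ v + + h) <? f̃ (γᵥ v)) ≡ ∑ (allFin m) (area h) ℕ.+ ∑ (allFin m) (path h)
      split h = begin
        𝟙 (f̃ (γᵥ v + + h) <? f̃ (γᵥ v))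
          ≡⟨ cong (λ c → 𝟙 (f̃ (γᵥ v + + h) <? c)) (f̃-γᵥ v) ⟩
        𝟙 (f̃ (γᵥ v + + h) <? + Υ P v)
          ≡⟨ f̃<Υ-split (γᵥ v + + h) v ⟩
        𝟙 (below-γ? (γᵥ v + + h)) ℕ.+ 𝟙 (on-γ-smaller? (γᵥ v + + h) v)
          ≡⟨ cong₂ ℕ._+_ (∑-rows-below (γᵥ v + + h)) (∑-rows-on (γᵥ v + + h) v) ⟨
        ∑ (allFin m) (area h) ℕ.+ ∑ (allFin m) (path h) ∎

  pathCrossings≡ : ∀ i v → pathCrossings i v ≡ 𝟙 (hits? (D P) (γᵥ i) v ×-dec (Υ P i ℕ.<? Υ P v))
  pathCrossings≡ i v = by-label (Υ P i ℕ.<? Υ P v)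
    where
      by-label : (Υi<Υv? : Dec (Υ P i ℕ.< Υ P v)) →
                 ∑ (oneTo n) (λ h → 𝟙 ((γᵥ v + + h ≟ γᵥ i) ×-dec Υi<Υv?)) ≡ 𝟙 (hits? (D P) (γᵥ i) v ×-dec Υi<Υv?)
      by-label (no Υi≮Υv) =
        trans (∑-zero (oneTo n) _ (λ h → 𝟙-no (Υi≮Υv ∘ proj₂) ((γᵥ v + + h ≟ γᵥ i) ×-dec no Υi≮Υv)))
              (sym (𝟙-no (Υi≮Υv ∘ proj₂) (hits? (D P) (γᵥ i) v ×-dec no Υi≮Υv)))
      by-label (yes Υi<Υv) = begin
        ∑ (oneTo n) (λ h → 𝟙 ((γᵥ v + + h ≟ γᵥ i) ×-dec yes Υi<Υv))
          ≡⟨ ∑-cong (oneTo n) (λ h → 𝟙-cong ((γᵥ v + + h ≟ γᵥ i) ×-dec yes Υi<Υv) (γᵥ v + + h ≟ γᵥ i)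
                                              proj₁ (λ e → e , Υi<Υv)) ⟩
        ∑ (oneTo n) (λ h → 𝟙 (γᵥ v + + h ≟ γᵥ i))
          ≡⟨ ∑-oneTo-𝟙[b+h≡g] n (γᵥ v) (γᵥ i) γi≢γv ⟩
        𝟙 (hits? (D P) (γᵥ i) v)
          ≡⟨ 𝟙-cong (hits? (D P) (γᵥ i) v) (hits? (D P) (γᵥ i) v ×-dec yes Υi<Υv) (λ hit → hit , Υi<Υv) proj₁ ⟩
        𝟙 (hits? (D P) (γᵥ i) v ×-dec yes Υi<Υv) ∎
        where
          open ≡-Reasoning
          γi≢γv : γᵥ i ≢ γᵥ v
          γi≢γv γi≡γv = ℕP.<-irrefl (cong (Υ P) (trans (sym (index-G i refl)) (index-G v γi≡γv))) Υi<Υv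

  γ-box : Fin m → ℕ → ℤ
  γ-box i x = γ m n (+ x) (+ (m ℕ.∸ toℕ i))

  γ-box-right : ∀ i q → γ-box i (a (D P) i ℕ.+ suc q) ≡ γᵥ i + -[1+ q ] * + m
  γ-box-right i q =
    trans (γ-row (D P) i (a (D P) i ℕ.+ suc q)) (cong (λ p → γᵥ i + p * + m) (lemma (+ a (D P) i) (+ suc q)))
    where lemma : ∀ a s → a - (a + s) ≡ - s
          lemma = solve-∀

  γ-box-injective : ∀ i {x x′} → γ-box i x ≡ γ-box i x′ → x ≡ x′
  γ-box-injective i {x} {x′} e =
    ℤP.+-injective (ℤP.neg-injective (+-cancelˡ-≡ (+ a (D P) i)
      (proj₂ (γv-injective-mod (D P) cop i i (+ a (D P) i - + x) (+ a (D P) i - + x′)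
        (trans (sym (γ-row (D P) i x)) (trans e (γ-row (D P) i x′)))))))

  area-box-below : ∀ i x → IsAreaBox (D P) i x → index (γ-box i x) ≡ i × γ-box i x < γᵥ i
  area-box-below i x (a<x , _) = index-γ-box , subst (_< γᵥ i) (sym γ-box≡) (shift-down (γᵥ i) { -[1+ q ]} ℤ.-<+)
    where
      q : ℕ
      q = x ℕ.∸ suc (a (D P) i)
      x≡ : x ≡ a (D P) i ℕ.+ suc q
      x≡ = trans (sym (ℕP.m+[n∸m]≡n a<x)) (sym (ℕP.+-suc (a (D P) i) q))
      γ-box≡ : γ-box i x ≡ γᵥ i + -[1+ q ] * + m
      γ-box≡ = trans (cong (γ-box i) x≡) (γ-box-right i q)
      index-γ-box : index (γ-box i x) ≡ i
      index-γ-box = proj₁ (decomposition-unique (γ-box i x) i -[1+ q ] γ-box≡)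

  below⇒negative : ∀ {g} j p → g ≡ γᵥ j + p * + m → g < γᵥ j → ∃ λ q → p ≡ -[1+ q ]
  below⇒negative j -[1+ q ] _  _   = q , refl
  below⇒negative j (+ p)    g≡ g<γ =
    ⊥-elim (ℤP.<⇒≱ g<γ (subst (γᵥ j ≤_) (sym g≡)
      (subst (λ z → γᵥ j ≤ γᵥ j + z) (ℤP.pos-* p m) (ℤP.i≤i+j (γᵥ j) (+ (p ℕ.* m))))))

  -- The area boxes of row i are x = a_i + 1 + q, with γ-value γ(v_i) - (1 + q) m ≥ 0.
  ∑-row-area-boxes : ∀ i g → 0ℤ ≤ g →
    ∑ (oneTo n) (λ x → 𝟙 (isAreaBox? (D P) i x) ℕ.* 𝟙 (g ≟ γ-box i x)) ≡ 𝟙 ((index g FinP.≟ i) ×-dec (g <? γᵥ i))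
  ∑-row-area-boxes i g 0≤g = by-class ((index g FinP.≟ i) ×-dec (g <? γᵥ i))
    where
      by-class : (below? : Dec (index g ≡ i × g < γᵥ i)) →
                 ∑ (oneTo n) (λ x → 𝟙 (isAreaBox? (D P) i x) ℕ.* 𝟙 (g ≟ γ-box i x)) ≡ 𝟙 below?
      by-class (no ¬below) = ∑-oneTo-zero n _ (λ x _ _ →
        𝟙*𝟙≡0 (isAreaBox? (D P) i x) (g ≟ γ-box i x)
          (λ area g≡ → ¬below (subst (λ z → index z ≡ i × z < γᵥ i) (sym g≡) (area-box-below i x area))))
      by-class (yes (index≡i , g<γ)) =
        trans (∑-oneTo-single n _ x₀ 1≤x₀ x₀≤n others)
              (cong₂ ℕ._*_ (𝟙-yes x₀-area (isAreaBox? (D P) i x₀)) (𝟙-yes g≡γ-box (g ≟ γ-box i x₀)))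
        where
          g≡γ+level : g ≡ γᵥ i + level g * + m
          g≡γ+level = trans (decomposition g) (cong (λ j → γᵥ j + level g * + m) index≡i)
          q : ℕ
          q = proj₁ (below⇒negative i (level g) g≡γ+level g<γ)
          x₀ : ℕ
          x₀ = a (D P) i ℕ.+ suc q
          g≡γ-box : g ≡ γ-box i x₀
          g≡γ-box = trans g≡γ+level
            (trans (cong (λ p → γᵥ i + p * + m) (proj₂ (below⇒negative i (level g) g≡γ+level g<γ)))
                   (sym (γ-box-right i q)))
          below-line : m ℕ.* x₀ ℕ.+ n ℕ.* (m ℕ.∸ toℕ i) ℕ.≤ m ℕ.* n
          below-line = 0≤γ⇒below {m} {n} x₀ (m ℕ.∸ toℕ i) (subst (0ℤ ≤_) g≡γ-box 0≤g)
          a<x₀ : suc (a (D P) i) ℕ.≤ x₀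
          a<x₀ = subst (suc (a (D P) i) ℕ.≤_) (sym (ℕP.+-suc (a (D P) i) q)) (s≤s (ℕP.m≤m+n (a (D P) i) q))
          x₀-area : IsAreaBox (D P) i x₀
          x₀-area = a<x₀ , below-line
          1≤x₀ : 1 ℕ.≤ x₀
          1≤x₀ = ℕP.≤-trans (s≤s z≤n) a<x₀
          x₀≤n : x₀ ℕ.≤ n
          x₀≤n = ℕP.*-cancelˡ-≤ m (ℕP.≤-trans (ℕP.m≤m+n (m ℕ.* x₀) _) below-line)
          others : ∀ x → 1 ℕ.≤ x → x ℕ.≤ n → x ≢ x₀ → 𝟙 (isAreaBox? (D P) i x) ℕ.* 𝟙 (g ≟ γ-box i x) ≡ 0
          others x _ _ x≢x₀ = 𝟙*𝟙≡0 (isAreaBox? (D P) i x) (g ≟ γ-box i x)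
            (λ _ g≡ → x≢x₀ (γ-box-injective i (trans (sym g≡) g≡γ-box)))

  areaBoxCrossing : Fin m → ℕ → Fin m → ℕ
  areaBoxCrossing i x v = 𝟙 (isAreaBox? (D P) i x) ℕ.* 𝟙 (hits? (D P) (γ-box i x) v)

  areaCrossings≡ : ∀ i v → areaCrossings i v ≡ ∑ (oneTo n) (λ x → areaBoxCrossing i x v)
  areaCrossings≡ i v = begin
    areaCrossings i v
      ≡⟨ ∑-cong (oneTo n) (λ h → ∑-row-area-boxes i (γᵥ v + + h) (0≤γᵥ+h h)) ⟨
    ∑ (oneTo n) (λ h → ∑ (oneTo n) (λ x → 𝟙 (isAreaBox? (D P) i x) ℕ.* 𝟙 (γᵥ v + + h ≟ γ-box i x)))
      ≡⟨ ∑-swap (oneTo n) (oneTo n) (λ h x → 𝟙 (isAreaBox? (D P) i x) ℕ.* 𝟙 (γᵥ v + + h ≟ γ-box i x)) ⟩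
    ∑ (oneTo n) (λ x → ∑ (oneTo n) (λ h → 𝟙 (isAreaBox? (D P) i x) ℕ.* 𝟙 (γᵥ v + + h ≟ γ-box i x)))
      ≡⟨ ∑-cong (oneTo n) (λ x → ∑-*ˡ (oneTo n) (𝟙 (isAreaBox? (D P) i x)) (λ h → 𝟙 (γᵥ v + + h ≟ γ-box i x))) ⟩
    ∑ (oneTo n) (λ x → 𝟙 (isAreaBox? (D P) i x) ℕ.* ∑ (oneTo n) (λ h → 𝟙 (γᵥ v + + h ≟ γ-box i x)))
      ≡⟨ ∑-cong (oneTo n) (λ x → crossing-count x (isAreaBox? (D P) i x)) ⟩
    ∑ (oneTo n) (λ x → areaBoxCrossing i x v) ∎
    where
      open ≡-Reasoning
      0≤γᵥ+h : ∀ h → 0ℤ ≤ γᵥ v + + h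
      0≤γᵥ+h h = ℤP.≤-trans (0≤γv (D P) v) (ℤP.i≤i+j (γᵥ v) (+ h))
      crossing-count : ∀ x (area? : Dec (IsAreaBox (D P) i x)) →
        𝟙 area? ℕ.* ∑ (oneTo n) (λ h → 𝟙 (γᵥ v + + h ≟ γ-box i x)) ≡ 𝟙 area? ℕ.* 𝟙 (hits? (D P) (γ-box i x) v)
      crossing-count x (no _)    = refl
      crossing-count x (yes area) = cong (1 ℕ.*_) (∑-oneTo-𝟙[b+h≡g] n (γᵥ v) (γ-box i x) γ-box≢γᵥ)
        where
          γ-box≢γᵥ : γ-box i x ≢ γᵥ v
          γ-box≢γᵥ e =
            ℤP.<-irrefl (trans e (cong γᵥ (trans (sym (index-G v e)) (proj₁ (area-box-below i x area)))))
                        (proj₂ (area-box-below i x area))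

  areaSum≡ : areaSum P ≡ ∑ (allFin m) (λ v → ∑ (allFin m) (λ i → areaCrossings i v))
  areaSum≡ = begin
    areaSum P
      ≡⟨ ∑-cong (allFin m) (λ i → ∑-cong (oneTo n) (λ x → box-term i x)) ⟩
    ∑ (allFin m) (λ i → ∑ (oneTo n) (λ x → ∑ (allFin m) (areaBoxCrossing i x)))
      ≡⟨ ∑-cong (allFin m) (λ i → ∑-swap (oneTo n) (allFin m) (areaBoxCrossing i)) ⟩
    ∑ (allFin m) (λ i → ∑ (allFin m) (λ v → ∑ (oneTo n) (λ x → areaBoxCrossing i x v)))
      ≡⟨ ∑-swap (allFin m) (allFin m) (λ i v → ∑ (oneTo n) (λ x → areaBoxCrossing i x v)) ⟩
    ∑ (allFin m) (λ v → ∑ (allFin m) (λ i → ∑ (oneTo n) (λ x → areaBoxCrossing i x v)))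
      ≡⟨ ∑-cong (allFin m) (λ v → ∑-cong (allFin m) (λ i → areaCrossings≡ i v)) ⟨
    ∑ (allFin m) (λ v → ∑ (allFin m) (λ i → areaCrossings i v)) ∎
    where
      open ≡-Reasoning
      box-term : ∀ i x →
        (if ⌊ isAreaBox? (D P) i x ⌋ then codinvArea P i x else 0) ≡ ∑ (allFin m) (areaBoxCrossing i x)
      box-term i x = begin
        (if ⌊ isAreaBox? (D P) i x ⌋ then codinvArea P i x else 0)
          ≡⟨ if-then-else-0≡𝟙* (isAreaBox? (D P) i x) (codinvArea P i x) ⟩
        𝟙 (isAreaBox? (D P) i x) ℕ.* codinvArea P i x
          ≡⟨ cong (𝟙 (isAreaBox? (D P) i x) ℕ.*_) (length-filter≡∑𝟙 (hits? (D P) (γ-box i x)) (allFin m)) ⟩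
        𝟙 (isAreaBox? (D P) i x) ℕ.* ∑ (allFin m) (λ v → 𝟙 (hits? (D P) (γ-box i x) v))
          ≡⟨ ∑-*ˡ (allFin m) (𝟙 (isAreaBox? (D P) i x)) (λ v → 𝟙 (hits? (D P) (γ-box i x) v)) ⟨
        ∑ (allFin m) (areaBoxCrossing i x) ∎

  pathSum≡ : pathSum P ≡ ∑ (allFin m) (λ v → ∑ (allFin m) (λ i → pathCrossings i v))
  pathSum≡ = begin
    pathSum P
      ≡⟨ ∑-cong (allFin m) (λ i →
           length-filter≡∑𝟙 (λ v → hits? (D P) (γᵥ i) v ×-dec (Υ P i ℕ.<? Υ P v)) (allFin m)) ⟩
    ∑ (allFin m) (λ i → ∑ (allFin m) (λ v → 𝟙 (hits? (D P) (γᵥ i) v ×-dec (Υ P i ℕ.<? Υ P v))))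
      ≡⟨ ∑-swap (allFin m) (allFin m) (λ i v → 𝟙 (hits? (D P) (γᵥ i) v ×-dec (Υ P i ℕ.<? Υ P v))) ⟩
    ∑ (allFin m) (λ v → ∑ (allFin m) (λ i → 𝟙 (hits? (D P) (γᵥ i) v ×-dec (Υ P i ℕ.<? Υ P v))))
      ≡⟨ ∑-cong (allFin m) (λ v → ∑-cong (allFin m) (λ i → pathCrossings≡ i v)) ⟨
    ∑ (allFin m) (λ v → ∑ (allFin m) (λ i → pathCrossings i v)) ∎
    where open ≡-Reasoning

  module Standardisation (k : ℤ) {σ τ : ℤ → ℤ} (std : IsStdPerm P k σ τ) where
    open IsStdPerm std
    open IsAffinePerm affine

    f-factors : ∀ x → FW P (σ x) (f̃ (x + k))
    f-factors x = factor x (f̃ (x + k)) (f̃-graph (x + k))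

    σ-descent⇒f̃-descent : ∀ {x y} → x < y → σ y < σ x → f̃ (y + k) < f̃ (x + k)
    σ-descent⇒f̃-descent {x} {y} x<y σy<σx = by-cmp (ℤP.<-cmp (f̃ (y + k)) (f̃ (x + k)))
      where
        by-cmp : Tri (f̃ (y + k) < f̃ (x + k)) (f̃ (y + k) ≡ f̃ (x + k)) (f̃ (x + k) < f̃ (y + k)) →
                 f̃ (y + k) < f̃ (x + k)
        by-cmp (tri< lt _ _) = lt
        by-cmp (tri≈ _ eq _) = ⊥-elim (ℤP.<-asym x<y (subst₂ _<_ (leftInv y) (leftInv x)
          (order (σ y) (σ x) (f̃ (x + k)) σy<σx (subst (FW P (σ y)) eq (f-factors y)) (f-factors x))))
        by-cmp (tri> _ _ gt) = ⊥-elim (ℤP.<⇒≱ gt (FW-monotone P σy<σx (f-factors y) (f-factors x)))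

    f̃-descent⇒σ-descent : ∀ {x y} → x < y → f̃ (y + k) < f̃ (x + k) → σ y < σ x
    f̃-descent⇒σ-descent {x} {y} x<y f̃-descent = by-cmp (ℤP.<-cmp (σ y) (σ x))
      where
        by-cmp : Tri (σ y < σ x) (σ y ≡ σ x) (σ x < σ y) → σ y < σ x
        by-cmp (tri< lt _ _) = lt
        by-cmp (tri≈ _ eq _) =
          ⊥-elim (ℤP.<-irrefl (trans (sym (leftInv x)) (trans (cong τ (sym eq)) (leftInv y))) x<y)
        by-cmp (tri> _ _ gt) = ⊥-elim (ℤP.<⇒≱ f̃-descent (FW-monotone P gt (f-factors x) (f-factors y)))

    codinv≡∑descents : codinvω m n σ ≡ ∑ (oneTo m) (λ i → descents (+ i + k))
    codinv≡∑descents = begin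
      codinvω m n σ
        ≡⟨ length-filter≡∑𝟙 σ-descent? pairs ⟩
      ∑ pairs (λ ih → 𝟙 (σ-descent? ih))
        ≡⟨ ∑-concatMap (oneTo m) (λ i → map (i ,_) (oneTo n)) (λ ih → 𝟙 (σ-descent? ih)) ⟩
      ∑ (oneTo m) (λ i → ∑ (map (i ,_) (oneTo n)) (λ ih → 𝟙 (σ-descent? ih)))
        ≡⟨ ∑-cong (oneTo m) (λ i → ∑-map (oneTo n) (i ,_) (λ ih → 𝟙 (σ-descent? ih))) ⟩
      ∑ (oneTo m) (λ i → ∑ (oneTo n) (λ h → 𝟙 (σ (+ (i ℕ.+ h)) <? σ (+ i))))
        ≡⟨ ∑-cong (oneTo m) (λ i → ∑-oneTo-cong n (descent-at i)) ⟩
      ∑ (oneTo m) (λ i → descents (+ i + k)) ∎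
      where
        open ≡-Reasoning
        pairs : List (ℕ × ℕ)
        pairs = concatMap (λ i → map (i ,_) (oneTo n)) (oneTo m)
        σ-descent? : ∀ ih → Dec (σ (+ (proj₁ ih ℕ.+ proj₂ ih)) < σ (+ proj₁ ih))
        σ-descent? ih = σ (+ (proj₁ ih ℕ.+ proj₂ ih)) <? σ (+ proj₁ ih)
        descent-at : ∀ i h → 𝟙 (σ (+ (i ℕ.+ suc h)) <? σ (+ i)) ≡ 𝟙 (f̃ (+ i + k + + suc h) <? f̃ (+ i + k))
        descent-at i h = 𝟙-cong (σ (+ (i ℕ.+ suc h)) <? σ (+ i)) (f̃ (+ i + k + + suc h) <? f̃ (+ i + k))
          (λ lt → subst (_< f̃ (+ i + k)) shift (σ-descent⇒f̃-descent i<i+1+h lt))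
          (λ lt → f̃-descent⇒σ-descent i<i+1+h (subst (_< f̃ (+ i + k)) (sym shift) lt))
          where
            i<i+1+h : + i < + (i ℕ.+ suc h)
            i<i+1+h = ℤ.+<+ (ℕP.m<m+n i (s≤s z≤n))
            shift : f̃ (+ (i ℕ.+ suc h) + k) ≡ f̃ (+ i + k + + suc h)
            shift = cong f̃ (lemma (+ i) (+ suc h) k)
              where lemma : ∀ a b k → a + b + k ≡ a + k + b
                    lemma = solve-∀

open import Data.Nat using (_+_; _<_)

mainTheorem15 : (m n r : ℕ) → 0 < m → 0 < n → 0 < r → Coprime m n →
    (P : SSPF m n r) → (k : ℤ) → ShiftK P k →
    (σ τ : ℤ → ℤ) → IsStdPerm P k σ τ →
    codinvω m n σ ≡ areaSum P + pathSum P
mainTheorem15 m n r 0<m _ _ cop P k _ σ τ std = begin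
  codinvω m n σ
    ≡⟨ codinv≡∑descents ⟩
  ∑ (oneTo m) (λ i → descents (+ i ℤ.+ k))
    ≡⟨ ∑-window≡∑-G descents descents-periodic k ⟩
  ∑ (allFin m) (descents ∘ γᵥ)
    ≡⟨ ∑-cong (allFin m) descents-γᵥ ⟩
  ∑ (allFin m) (λ v → ∑ (allFin m) (λ i → areaCrossings i v) + ∑ (allFin m) (λ i → pathCrossings i v))
    ≡⟨ ∑-+ (allFin m) (λ v → ∑ (allFin m) (λ i → areaCrossings i v)) (λ v → ∑ (allFin m) (λ i → pathCrossings i v)) ⟩
  ∑ (allFin m) (λ v → ∑ (allFin m) (λ i → areaCrossings i v)) + ∑ (allFin m) (λ v → ∑ (allFin m) (λ i → pathCrossings i v))
    ≡⟨ cong₂ _+_ areaSum≡ pathSum≡ ⟨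
  areaSum P + pathSum P ∎
  where
    open ≡-Reasoning
    instance
      m≢0 : ℕ.NonZero m
      m≢0 = ℕ.>-nonZero 0<m
    open Codinversions cop P
    open Standardisation k std
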